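{- If $n=2k\ge 2$ is even, then $\phi(F_n)\le n-1$.
   Context: For $u\in\{0,1\}^n$, $\overline{u}=u+(1,\dots,1)\pmod 2$. The folded hypercube $F_n$ has vertex set $\{\{u,\overline{u}\}:u\in\{0,1\}^n\}$, with $\{u,\overline u\}$ adjacent to $\{v,\overline v\}$ iff $u$ and $v$, or $u$ and $\overline v$, differ in exactly one coordinate; its distance is $\min\{h,n-h\}$ where $h$ is the Hamming distance of $u,v$. In a graph $G$, a pair $\{x,y\}$ doubly resolves $\{u,v\}$ if $d_G(u,x)-d_G(u,y)\neq d_G(v,x)-d_G(v,y)$. For a vertex $x$, $T\subseteq V(G)$ is a doubly distance resolving set of $G$ on $x$ if every pair $\{u,v\}$ with $d_G(u,x)\neq d_G(v,x)$ is doubly resolved by some pair of vertices of $T\cup\{x\}$; $\phi(G,x)$ is the minimum size of such a set, and $\phi(G)=\max\{\phi(G,x):x\in V(G)\}$. -}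

module Defs where

open import Data.Bool using (Bool; true; false; not; _xor_; if_then_else_)
open import Data.Nat using (ℕ; zero; suc; _+_; _∸_; _⊓_; _≤_)
open import Data.Vec using (Vec; []; _∷_; map)
open import Data.List using (List; _∷_; length)
open import Data.List.Membership.Propositional using (_∈_)
open import Data.Integer as ℤ using (ℤ; +_)
open import Data.Product using (Σ; _×_; ∃-syntax)
open import Relation.Binary.PropositionalEquality using (_≡_; _≢_)

-- A vertex {u, ū} of the folded hypercube F_n is represented by either
-- representative u ∈ {0,1}^n.  All notions below are invariant under
-- replacing a representative u by its complement ū.
Word : ℕ → Set
Word n = Vec Bool n

compl : ∀ {n} → Word n → Word n
compl = map not

hamming : ∀ {n} → Word n → Word n → ℕ
hamming [] [] = 0
hamming (a ∷ u) (b ∷ v) = (if a xor b then 1 else 0) + hamming u v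

distF : ∀ n → Word n → Word n → ℕ
distF n u v = hamming u v ⊓ (n ∸ hamming u v)

DoublyResolves : ∀ n → Word n → Word n → Word n → Word n → Set
DoublyResolves n x y u v =
  (+ distF n u x ℤ.- + distF n u y) ≢ (+ distF n v x ℤ.- + distF n v y)

-- T is a doubly distance resolving set of F_n on x
-- (T a finite set of vertices, given by a list of representatives)
IsDDRSOn : ∀ n → Word n → List (Word n) → Set
IsDDRSOn n x T =
  ∀ (u v : Word n) → distF n u x ≢ distF n v x →
  ∃[ a ] ∃[ b ] (a ∈ x ∷ T) × (b ∈ x ∷ T) × DoublyResolves n a b u v

φOn≤ : ∀ n → Word n → ℕ → Set
φOn≤ n x m = ∃[ T ] length T ≤ m × IsDDRSOn n x T

-- φ(F_n) ≤ m : φ(F_n, x) ≤ m for every vertex x (φ is a maximum)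
φ≤ : ℕ → ℕ → Set
φ≤ n m = ∀ (x : Word n) → φOn≤ n x m

-- Translating by x reduces everything to x = 0, where {a, 0} fails to doubly resolve {u, v}
-- exactly when d(u,a) − d(u,0) = d(v,a) − d(v,0).  For n = 2k ≥ 4 take the n − 1 vectors
-- e₁+e₂, e₃, …, eₙ.  Choosing representatives of weight ≤ k makes d(·,0) the weight; say
-- |u| < |v|.  If |v| = k then d(v,eᵢ) = k − 1 for every i, which forces uᵢ = 1 for all i ≥ 3,
-- so |u| ≥ n − 2 ≥ k: impossible.  If |v| < k the unit vectors force u and v to agree outside
-- the first two coordinates; then d(w, e₁+e₂) + |w| takes the same value on u and v, so
-- e₁+e₂ separates them.  For n = 2 the single vector e₁ works, by exhaustion.
module Submission where

open import Defs
open import Data.Nat using (ℕ; zero; suc; _+_; _*_; _∸_; _≤_; _<_; _⊓_; z≤n; s≤s; _≟_; _≤?_)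
open import Data.Nat.Properties
open import Data.Bool using (true; false; _xor_; if_then_else_)
open import Data.Bool.Properties using (xor-assoc; xor-comm; xor-identityˡ)
open import Data.Vec using ([]; _∷_; zipWith; lookup; replicate; _[_]≔_)
open import Data.Vec.Properties using (tabulate∘lookup; tabulate-cong; lookup-replicate; zipWith-identityˡ)
open import Data.Fin using (Fin; zero; suc)
import Data.List as List
open import Data.List using (List; []; _∷_; length)
open import Data.List.Properties using (length-map; length-tabulate)
open import Data.List.Relation.Unary.All as All using (All; []; _∷_; all?)
open import Data.List.Relation.Unary.All.Properties using (¬All⇒Any¬; map⁻)
open import Data.List.Relation.Unary.Any using (here; there)
open import Data.List.Membership.Propositional using (find)
open import Data.List.Membership.Propositional.Properties using (∈-tabulate⁺)
open import Data.Integer as ℤ using (+_)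
import Data.Integer.Properties as ℤ
open import Data.Integer.Tactic.RingSolver using (solve-∀)
open import Data.Product using (_×_; ∃-syntax; _,_)
open import Data.Sum using (_⊎_; inj₁; inj₂)
open import Data.Empty using (⊥; ⊥-elim)
open import Relation.Nullary using (¬_; Dec; yes; no)
open import Relation.Binary using (tri<; tri≈; tri>)
open import Relation.Binary.PropositionalEquality

m-n≡o-p⇒m+p≡o+n : ∀ m n o p → + m ℤ.- + n ≡ + o ℤ.- + p → m + p ≡ o + n
m-n≡o-p⇒m+p≡o+n m n o p eq = ℤ.+-injective (begin
  + (m + p)                       ≡⟨ ℤ.pos-+ m p ⟩
  + m ℤ.+ + p                     ≡⟨ cancel (+ m) (+ n) (+ p) ⟨
  (+ m ℤ.- + n) ℤ.+ (+ n ℤ.+ + p) ≡⟨ cong (ℤ._+ (+ n ℤ.+ + p)) eq ⟩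
  (+ o ℤ.- + p) ℤ.+ (+ n ℤ.+ + p) ≡⟨ cong (λ x → (+ o ℤ.- + p) ℤ.+ x) (ℤ.+-comm (+ n) (+ p)) ⟩
  (+ o ℤ.- + p) ℤ.+ (+ p ℤ.+ + n) ≡⟨ cancel (+ o) (+ p) (+ n) ⟩
  + o ℤ.+ + n                     ≡⟨ ℤ.pos-+ o n ⟨
  + (o + n)                       ∎)
  where
  open ≡-Reasoning
  cancel : ∀ a b c → (a ℤ.- b) ℤ.+ (b ℤ.+ c) ≡ a ℤ.+ c
  cancel = solve-∀

m+n≢1+n+1+m : ∀ m n → m + n ≢ suc n + suc m
m+n≢1+n+1+m m n eq =
  <-irrefl eq (≤-trans (+-mono-< (n<1+n m) (n<1+n n)) (≤-reflexive (+-comm (suc m) (suc n))))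

_⊕_ : ∀ {n} → Word n → Word n → Word n
_⊕_ = zipWith _xor_

zeros : ∀ n → Word n
zeros n = replicate n false

weight : ∀ {n} → Word n → ℕ
weight u = hamming u (zeros _)

hamming-⊕ : ∀ {n} (u a x : Word n) → hamming u (a ⊕ x) ≡ hamming (u ⊕ x) a
hamming-⊕ [] [] [] = refl
hamming-⊕ (b ∷ u) (c ∷ a) (y ∷ x) =
  cong₂ _+_ (cong (λ z → if z then 1 else 0) xor-swap) (hamming-⊕ u a x)
  where
  xor-swap : b xor (c xor y) ≡ (b xor y) xor c
  xor-swap = trans (cong (b xor_) (xor-comm c y)) (sym (xor-assoc b y c))

hamming≡weight-⊕ : ∀ {n} (u x : Word n) → hamming u x ≡ weight (u ⊕ x)
hamming≡weight-⊕ u x =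
  trans (cong (hamming u) (sym (zipWith-identityˡ xor-identityˡ x))) (hamming-⊕ u (zeros _) x)

distF-⊕ : ∀ n (u a x : Word n) → distF n u (a ⊕ x) ≡ distF n (u ⊕ x) a
distF-⊕ n u a x = cong (λ h → h ⊓ (n ∸ h)) (hamming-⊕ u a x)

distF≡distF-zeros-⊕ : ∀ n (u x : Word n) → distF n u x ≡ distF n (u ⊕ x) (zeros n)
distF≡distF-zeros-⊕ n u x = cong (λ h → h ⊓ (n ∸ h)) (hamming≡weight-⊕ u x)

-- The pair {a, x} does not doubly resolve {u, v}, with the subtractions moved across.
Balanced : ∀ n → Word n → Word n → Word n → Word n → Set
Balanced n x u v a = distF n u a + distF n v x ≡ distF n v a + distF n u x

¬Balanced⇒DoublyResolves : ∀ n (x u v a : Word n) → ¬ Balanced n x u v a → DoublyResolves n a x u v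
¬Balanced⇒DoublyResolves n x u v a ¬bal eq =
  ¬bal (m-n≡o-p⇒m+p≡o+n (distF n u a) (distF n u x) (distF n v a) (distF n v x) eq)

Balanced-resp : ∀ {n} {x : Word n} u u′ v v′ →
                (∀ t → distF n u′ t ≡ distF n u t) → (∀ t → distF n v′ t ≡ distF n v t) →
                ∀ a → Balanced n x u v a → Balanced n x u′ v′ a
Balanced-resp {x = x} u u′ v v′ du dv a bal =
  trans (cong₂ _+_ (du a) (dv x)) (trans bal (sym (cong₂ _+_ (dv a) (du x))))

Balanced-⊕ : ∀ n (x u v a : Word n) →
             Balanced n x u v (a ⊕ x) → Balanced n (zeros n) (u ⊕ x) (v ⊕ x) a
Balanced-⊕ n x u v a = subst₂ _≡_
  (cong₂ _+_ (distF-⊕ n u a x) (distF≡distF-zeros-⊕ n v x))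
  (cong₂ _+_ (distF-⊕ n v a x) (distF≡distF-zeros-⊕ n u x))

ResolvesAt : ∀ n → Word n → List (Word n) → Set
ResolvesAt n x T = ∀ u v → All (Balanced n x u v) T → distF n u x ≡ distF n v x

Balanced? : ∀ n (x u v a : Word n) → Dec (Balanced n x u v a)
Balanced? n x u v a = _ ≟ _

ResolvesAt⇒IsDDRSOn : ∀ n x (T : List (Word n)) → ResolvesAt n x T → IsDDRSOn n x T
ResolvesAt⇒IsDDRSOn n x T res u v d≢ with all? (Balanced? n x u v) T
... | yes bal = ⊥-elim (d≢ (res u v bal))
... | no ¬bal with find (¬All⇒Any¬ (Balanced? n x u v) T ¬bal)
...   | a , a∈T , ¬bal-a = a , x , there a∈T , here refl , ¬Balanced⇒DoublyResolves n x u v a ¬bal-a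

ResolvesAt-⊕ : ∀ n x (T : List (Word n)) → ResolvesAt n (zeros n) T → ResolvesAt n x (List.map (_⊕ x) T)
ResolvesAt-⊕ n x T res u v bal = begin
  distF n u x               ≡⟨ distF≡distF-zeros-⊕ n u x ⟩
  distF n (u ⊕ x) (zeros n) ≡⟨ res (u ⊕ x) (v ⊕ x) (All.map (λ {a} → Balanced-⊕ n x u v a) (map⁻ bal)) ⟩
  distF n (v ⊕ x) (zeros n) ≡⟨ distF≡distF-zeros-⊕ n v x ⟨
  distF n v x               ∎
  where open ≡-Reasoning

φ≤-from-zeros : ∀ n m (T : List (Word n)) → length T ≤ m → ResolvesAt n (zeros n) T → φ≤ n m
φ≤-from-zeros n m T len res x =
  List.map (_⊕ x) T ,
  subst (_≤ m) (sym (length-map (_⊕ x) T)) len ,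
  ResolvesAt⇒IsDDRSOn n x _ (ResolvesAt-⊕ n x T res)

hamming-compl : ∀ {n} (u t : Word n) → hamming (compl u) t + hamming u t ≡ n
hamming-compl [] [] = refl
hamming-compl (true ∷ u) (true ∷ t) = cong suc (hamming-compl u t)
hamming-compl (true ∷ u) (false ∷ t) = trans (+-suc _ _) (cong suc (hamming-compl u t))
hamming-compl (false ∷ u) (true ∷ t) = trans (+-suc _ _) (cong suc (hamming-compl u t))
hamming-compl (false ∷ u) (false ∷ t) = cong suc (hamming-compl u t)

hamming-compl≡∸ : ∀ {n} (u t : Word n) → hamming (compl u) t ≡ n ∸ hamming u t
hamming-compl≡∸ {n} u t = begin
  hamming (compl u) t                          ≡⟨ m+n∸n≡m (hamming (compl u) t) (hamming u t) ⟨
  hamming (compl u) t + hamming u t ∸ hamming u t ≡⟨ cong (_∸ hamming u t) (hamming-compl u t) ⟩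
  n ∸ hamming u t                              ∎
  where open ≡-Reasoning

hamming≤length : ∀ {n} (u t : Word n) → hamming u t ≤ n
hamming≤length u t = subst (hamming u t ≤_) (hamming-compl u t) (m≤n+m (hamming u t) (hamming (compl u) t))

distF-compl : ∀ n (u t : Word n) → distF n (compl u) t ≡ distF n u t
distF-compl n u t rewrite hamming-compl≡∸ u t =
  trans (cong ((n ∸ hamming u t) ⊓_) (m∸[m∸n]≡n (hamming≤length u t))) (⊓-comm _ _)

unit : ∀ {n} → Fin n → Word n
unit i = zeros _ [ i ]≔ true

hamming-unit-true : ∀ {n} (p : Word n) i → lookup p i ≡ true → suc (hamming p (unit i)) ≡ weight p
hamming-unit-true (true ∷ p) zero refl = refl
hamming-unit-true (b ∷ p) (suc i) eq =
  trans (sym (+-suc _ _)) (cong (λ h → _ + h) (hamming-unit-true p i eq))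

hamming-unit-false : ∀ {n} (p : Word n) i → lookup p i ≡ false → hamming p (unit i) ≡ suc (weight p)
hamming-unit-false (false ∷ p) zero refl = refl
hamming-unit-false (b ∷ p) (suc i) eq =
  trans (cong (λ h → _ + h) (hamming-unit-false p i eq)) (+-suc _ _)

hamming-unit : ∀ {n} (p : Word n) i →
               suc (hamming p (unit i)) ≡ weight p ⊎ hamming p (unit i) ≡ suc (weight p)
hamming-unit p i with lookup p i in eq
... | true = inj₁ (hamming-unit-true p i eq)
... | false = inj₂ (hamming-unit-false p i eq)

lookup-ext : ∀ {n} (p q : Word n) → (∀ i → lookup p i ≡ lookup q i) → p ≡ q
lookup-ext p q eq = trans (sym (tabulate∘lookup p)) (trans (tabulate-cong eq) (tabulate∘lookup q))

weight-ones : ∀ n → weight (replicate n true) ≡ n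
weight-ones zero = refl
weight-ones (suc n) = cong suc (weight-ones n)

weight-∷ : ∀ {n} b (p : Word n) → weight p ≤ weight (b ∷ p)
weight-∷ b p = m≤n+m (weight p) _

module EvenDimension (j : ℕ) where

  k N : ℕ
  k = suc j
  N = suc (suc (j + j))

  N≡2*k : N ≡ 2 * k
  N≡2*k = cong suc (trans (sym (+-suc j j)) (cong (λ h → j + suc h) (sym (+-identityʳ j))))

  -- distF N u t unfolds to fold (hamming u t), so Balanced N … is an equation between folds.
  fold : ℕ → ℕ
  fold h = h ⊓ (N ∸ h)

  N∸k≡k : N ∸ k ≡ k
  N∸k≡k = trans (cong (_∸ j) (sym (+-suc j j))) (m+n∸m≡n j k)

  fold-≤ : ∀ {h} → h ≤ k → fold h ≡ h
  fold-≤ {h} h≤k = m≤n⇒m⊓n≡m (≤-trans h≤k (subst (_≤ N ∸ h) N∸k≡k (∸-monoʳ-≤ N h≤k)))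

  fold-1+k : fold (suc k) ≡ j
  fold-1+k = trans (cong (suc k ⊓_) (m+n∸m≡n j j)) (m≥n⇒m⊓n≡n (≤-trans (n≤1+n j) (n≤1+n k)))

  fold-next-to-k : ∀ {h w} → w ≡ k → suc h ≡ w ⊎ h ≡ suc w → fold h ≡ j
  fold-next-to-k refl (inj₁ refl) = fold-≤ (n≤1+n j)
  fold-next-to-k refl (inj₂ refl) = fold-1+k

  unit-flip-unbalanced : ∀ {hu wu hv wv} → suc hu ≡ wu → hv ≡ suc wv → wu ≤ k → wv < k →
                         fold hu + fold wv ≡ fold hv + fold wu → ⊥
  unit-flip-unbalanced {hu} {wu} {hv} {wv} refl refl wu≤k wv<k eq =
    m+n≢1+n+1+m hu wv (begin
      hu + wv                 ≡⟨ cong₂ _+_ (fold-≤ (≤-trans (n≤1+n hu) wu≤k)) (fold-≤ (<⇒≤ wv<k)) ⟨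
      fold hu + fold wv       ≡⟨ eq ⟩
      fold hv + fold wu       ≡⟨ cong₂ _+_ (fold-≤ wv<k) (fold-≤ wu≤k) ⟩
      suc wv + suc hu         ∎)
    where open ≡-Reasoning

  unit-half-unbalanced : ∀ {hu wu hv wv} → hu ≡ suc wu → wu < wv → wv ≡ k → fold hv ≡ j →
                         fold hu + fold wv ≡ fold hv + fold wu → ⊥
  unit-half-unbalanced {hu} {wu} {hv} refl wu<k refl fold-hv eq =
    m+n≢1+n+1+m j wu (sym (begin
      suc wu + suc j          ≡⟨ cong₂ _+_ (fold-≤ wu<k) (fold-≤ ≤-refl) ⟨
      fold hu + fold k        ≡⟨ eq ⟩
      fold hv + fold wu       ≡⟨ cong₂ _+_ fold-hv (fold-≤ (<⇒≤ wu<k)) ⟩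
      j + wu                  ∎))
    where open ≡-Reasoning

  lead-unbalanced : ∀ {hu wu hv wv} t → t ≤ wu → wu < wv → wv < k →
                    hu + wu ≡ suc (suc (t + t)) → hv + wv ≡ suc (suc (t + t)) →
                    fold hu + fold wv ≡ fold hv + fold wu → ⊥
  lead-unbalanced {hu} {wu} {hv} {wv} t t≤wu wu<wv wv<k sum-u sum-v eq with ≤-total hv hu
  ... | inj₁ hv≤hu = <-irrefl (sym plain) (+-mono-≤-< hv≤hu wu<wv)
    where
    t<wv : t < wv
    t<wv = ≤-<-trans t≤wu wu<wv
    hu≤k : hu ≤ k
    hu≤k = ≤-trans (+-cancelʳ-≤ t hu (suc (suc t)) (≤-trans (+-monoʳ-≤ hu t≤wu) (≤-reflexive sum-u)))
                   (≤-trans (s≤s t<wv) wv<k)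
    hv≤k : hv ≤ k
    hv≤k = ≤-trans (+-cancelʳ-≤ (suc t) hv (suc t)
                      (≤-trans (+-monoʳ-≤ hv t<wv) (≤-reflexive (trans sum-v (cong suc (sym (+-suc t t)))))))
                   (≤-trans t<wv (<⇒≤ wv<k))
    plain : hu + wv ≡ hv + wu
    plain = trans (sym (cong₂ _+_ (fold-≤ hu≤k) (fold-≤ (<⇒≤ wv<k))))
                  (trans eq (cong₂ _+_ (fold-≤ hv≤k) (fold-≤ (<⇒≤ (<-trans wu<wv wv<k)))))
  ... | inj₂ hu≤hv = <-irrefl (trans sum-u (sym sum-v)) (+-mono-≤-< hu≤hv wu<wv)

  m : ℕ
  m = j + j

  lead : Word N
  lead = true ∷ true ∷ zeros m

  tailUnit : Fin m → Word N
  tailUnit i = unit (suc (suc i))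

  T₀ : List (Word N)
  T₀ = lead ∷ List.tabulate tailUnit

  length-T₀ : length T₀ ≡ N ∸ 1
  length-T₀ = cong suc (length-tabulate tailUnit)

  lead-sum : ∀ a b (p : Word m) →
             hamming (a ∷ b ∷ p) lead + weight (a ∷ b ∷ p) ≡ suc (suc (weight p + weight p))
  lead-sum true  true  p = trans (+-suc (weight p) (suc (weight p))) (cong suc (+-suc (weight p) (weight p)))
  lead-sum true  false p = cong suc (+-suc (weight p) (weight p))
  lead-sum false true  p = cong suc (+-suc (weight p) (weight p))
  lead-sum false false p = refl

  weight-tail≤ : ∀ a b (p : Word m) → weight p ≤ weight (a ∷ b ∷ p)
  weight-tail≤ a b p = ≤-trans (weight-∷ b p) (weight-∷ a (b ∷ p))

  lighter : ∀ (u : Word N) → ∃[ u′ ] weight u′ ≤ k × (∀ t → distF N u′ t ≡ distF N u t)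
  lighter u with weight u ≤? k
  ... | yes wu≤k = u , wu≤k , λ t → refl
  ... | no wu≰k = compl u , wcu≤k , distF-compl N u
    where
    wcu≤k : weight (compl u) ≤ k
    wcu≤k = subst (_≤ k) (sym (hamming-compl≡∸ u (zeros N)))
                  (≤-trans (∸-monoʳ-≤ N (<⇒≤ (≰⇒> wu≰k))) (≤-reflexive N∸k≡k))

  Balanced-tailUnit : ∀ u v → All (Balanced N (zeros N) u v) T₀ →
                      ∀ i → Balanced N (zeros N) u v (tailUnit i)
  Balanced-tailUnit u v (_ ∷ bal) i = All.lookup bal (∈-tabulate⁺ i)

  tail-bit-agrees : ∀ (u v : Word N) i → weight u < weight v → weight v < k →
                    Balanced N (zeros N) u v (tailUnit i) → lookup u (suc (suc i)) ≡ lookup v (suc (suc i))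
  tail-bit-agrees u v i wu<wv wv<k bal with lookup u (suc (suc i)) in eu | lookup v (suc (suc i)) in ev
  ... | true  | true  = refl
  ... | false | false = refl
  ... | true  | false = ⊥-elim (unit-flip-unbalanced (hamming-unit-true u _ eu) (hamming-unit-false v _ ev)
                                  (<⇒≤ (<-trans wu<wv wv<k)) wv<k bal)
  ... | false | true  = ⊥-elim (unit-flip-unbalanced (hamming-unit-true v _ ev) (hamming-unit-false u _ eu)
                                  (<⇒≤ wv<k) (<-trans wu<wv wv<k) (sym bal))

  tail-bit-set : ∀ (u v : Word N) i → weight u < weight v → weight v ≡ k →
                 Balanced N (zeros N) u v (tailUnit i) → lookup u (suc (suc i)) ≡ true
  tail-bit-set u v i wu<wv wv≡k bal with lookup u (suc (suc i)) in eu
  ... | true  = refl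
  ... | false = ⊥-elim (unit-half-unbalanced (hamming-unit-false u (suc (suc i)) eu) wu<wv wv≡k
                          (fold-next-to-k wv≡k (hamming-unit v (suc (suc i)))) bal)

  lighter-unbalanced : 1 ≤ j → ∀ (u v : Word N) → weight u < weight v → weight v ≤ k →
                       All (Balanced N (zeros N) u v) T₀ → ⊥
  lighter-unbalanced 1≤j u@(a ∷ b ∷ p) v@(a′ ∷ b′ ∷ q) wu<wv wv≤k bal with m≤n⇒m<n∨m≡n wv≤k
  ... | inj₂ wv≡k = <-irrefl refl (≤-trans (+-monoˡ-≤ j 1≤j) (≤-pred m<k))
    where
    p-full : p ≡ replicate m true
    p-full = lookup-ext p _ λ i →
      trans (tail-bit-set u v i wu<wv wv≡k (Balanced-tailUnit u v bal i)) (sym (lookup-replicate i true))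
    m≤wu : m ≤ weight u
    m≤wu = subst (_≤ weight u) (trans (cong weight p-full) (weight-ones m)) (weight-tail≤ a b p)
    m<k : m < k
    m<k = ≤-<-trans m≤wu (subst (weight u <_) wv≡k wu<wv)
  ... | inj₁ wv<k with lookup-ext q p (λ i → sym (tail-bit-agrees u v i wu<wv wv<k (Balanced-tailUnit u v bal i)))
  ...   | refl = lead-unbalanced (weight p) (weight-tail≤ a b p) wu<wv wv<k
                   (lead-sum a b p) (lead-sum a′ b′ p) (All.head bal)

  resolves-lighter : 1 ≤ j → ∀ (u v : Word N) → weight u ≤ k → weight v ≤ k →
                     All (Balanced N (zeros N) u v) T₀ → fold (weight u) ≡ fold (weight v)
  resolves-lighter 1≤j u v wu≤k wv≤k bal with <-cmp (weight u) (weight v)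
  ... | tri< wu<wv _ _ = ⊥-elim (lighter-unbalanced 1≤j u v wu<wv wv≤k bal)
  ... | tri≈ _ wu≡wv _ = cong fold wu≡wv
  ... | tri> _ _ wv<wu = ⊥-elim (lighter-unbalanced 1≤j v u wv<wu wu≤k (All.map sym bal))

  resolves : 1 ≤ j → ResolvesAt N (zeros N) T₀
  resolves 1≤j u v bal with lighter u | lighter v
  ... | u′ , wu′≤k , du | v′ , wv′≤k , dv = begin
    distF N u (zeros N)  ≡⟨ du (zeros N) ⟨
    distF N u′ (zeros N) ≡⟨ resolves-lighter 1≤j u′ v′ wu′≤k wv′≤k
                              (All.map (λ {a} → Balanced-resp u u′ v v′ du dv a) bal) ⟩
    distF N v′ (zeros N) ≡⟨ dv (zeros N) ⟩
    distF N v (zeros N)  ∎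
    where open ≡-Reasoning

T₂ : List (Word 2)
T₂ = (true ∷ false ∷ []) ∷ []

resolves₂ : ResolvesAt 2 (zeros 2) T₂
resolves₂ (true  ∷ true  ∷ []) (true  ∷ true  ∷ []) _ = refl
resolves₂ (true  ∷ true  ∷ []) (false ∷ false ∷ []) _ = refl
resolves₂ (false ∷ false ∷ []) (true  ∷ true  ∷ []) _ = refl
resolves₂ (false ∷ false ∷ []) (false ∷ false ∷ []) _ = refl
resolves₂ (true  ∷ false ∷ []) (true  ∷ false ∷ []) _ = refl
resolves₂ (true  ∷ false ∷ []) (false ∷ true  ∷ []) _ = refl
resolves₂ (false ∷ true  ∷ []) (true  ∷ false ∷ []) _ = refl
resolves₂ (false ∷ true  ∷ []) (false ∷ true  ∷ []) _ = refl
resolves₂ (true  ∷ true  ∷ []) (true  ∷ false ∷ []) (() ∷ [])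
resolves₂ (true  ∷ true  ∷ []) (false ∷ true  ∷ []) (() ∷ [])
resolves₂ (false ∷ false ∷ []) (true  ∷ false ∷ []) (() ∷ [])
resolves₂ (false ∷ false ∷ []) (false ∷ true  ∷ []) (() ∷ [])
resolves₂ (true  ∷ false ∷ []) (true  ∷ true  ∷ []) (() ∷ [])
resolves₂ (true  ∷ false ∷ []) (false ∷ false ∷ []) (() ∷ [])
resolves₂ (false ∷ true  ∷ []) (true  ∷ true  ∷ []) (() ∷ [])
resolves₂ (false ∷ true  ∷ []) (false ∷ false ∷ []) (() ∷ [])

lemma9 : (k : ℕ) → 1 ≤ k → φ≤ (2 * k) (2 * k ∸ 1)
lemma9 (suc zero) _ = φ≤-from-zeros 2 1 T₂ ≤-refl resolves₂
lemma9 (suc (suc j)) _ =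
  subst (λ n → φ≤ n (n ∸ 1)) N≡2*k
    (φ≤-from-zeros N (N ∸ 1) T₀ (≤-reflexive length-T₀) (resolves (s≤s z≤n)))
  where open EvenDimension (suc j)
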